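{- Let $n\geq0$. (a) The number of permutations in $\tilde{\mathfrak S}_{n+1}$ with no $3$-descents is $E_n$. (b) The number of permutations in $\mathfrak S_{n+1}$ with no $3$-descents is $(n+1)E_n$.
   Context: $\tilde{\mathfrak S}_{n+1}$ is the set of permutations of $[n+1]$ with first entry $1$. A permutation $\sigma$ has a $3$-descent at position $i$ if $\sigma_i\sigma_{i+1}\sigma_{i+2}$ (standardized) is an odd permutation in $\mathfrak S_3$. $E_n$ is the Euler number, the number of up-down permutations $\sigma_1<\sigma_2>\sigma_3<\cdots$ of $[n]$. -}

module Defs where

open import Data.Nat using (ℕ; zero; suc; _+_; _*_; _<ᵇ_)
open import Data.Nat.Properties using ()
open import Data.Bool using (Bool; true; false; _∧_; _∨_; not; _xor_; if_then_else_)
open import Data.Fin using (Fin; toℕ)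
open import Data.List using (List; []; _∷_; map; concatMap; length; filterᵇ; allFin)
open import Data.Vec using (Vec; []; _∷_; toList)
import Data.Vec as Vec

allWords : (k m : ℕ) → List (Vec (Fin m) k)
allWords zero    m = [] ∷ []
allWords (suc k) m = concatMap (λ a → map (a ∷_) (allWords k m)) (allFin m)

count : {A : Set} → (A → Bool) → List A → ℕ
count p xs = length (filterᵇ p xs)

vals : {k m : ℕ} → Vec (Fin m) k → List ℕ
vals v = toList (Vec.map toℕ v)

notIn : ℕ → List ℕ → Bool
notIn a []       = true
notIn a (b ∷ bs) = not (a Data.Nat.≡ᵇ b) ∧ notIn a bs
  where import Data.Nat

distinct : List ℕ → Bool
distinct []       = true
distinct (a ∷ as) = notIn a as ∧ distinct as

-- A word of length n over [n] with distinct entries is a permutation of [n]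
-- (one-line notation, values shifted down by 1).
isPerm : {n : ℕ} → Vec (Fin n) n → Bool
isPerm v = distinct (vals v)

-- The standardization of abc (distinct) is an odd permutation of S_3
-- iff its number of inversions is odd.
oddPattern : ℕ → ℕ → ℕ → Bool
oddPattern a b c = (b <ᵇ a) xor ((c <ᵇ a) xor (c <ᵇ b))

noThreeDescent : List ℕ → Bool
noThreeDescent (a ∷ b ∷ c ∷ rest) = not (oddPattern a b c) ∧ noThreeDescent (b ∷ c ∷ rest)
noThreeDescent _                  = true

alt : Bool → List ℕ → Bool
alt up (a ∷ b ∷ rest) = (if up then a <ᵇ b else b <ᵇ a) ∧ alt (not up) (b ∷ rest)
alt up _              = true

upDown : List ℕ → Bool
upDown = alt true

-- First entry is 1 (i.e. value 0 in 0-based notation).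
firstIsOne : List ℕ → Bool
firstIsOne (zero ∷ _) = true
firstIsOne _          = false

E : ℕ → ℕ
E n = count (λ v → isPerm v ∧ upDown (vals v)) (allWords n n)

countTildeNo3 : ℕ → ℕ
countTildeNo3 n = count (λ v → isPerm v ∧ firstIsOne (vals v) ∧ noThreeDescent (vals v))
                        (allWords (suc n) (suc n))

countNo3 : ℕ → ℕ
countNo3 n = count (λ v → isPerm v ∧ noThreeDescent (vals v)) (allWords (suc n) (suc n))

module Submission where

-- A permutation of [n+1] is its first value a followed by a permutation of [n]
-- relabelled by the order-preserving injection `punch a` that skips a.  All
-- properties in the statement (distinct entries, up-down, no 3-descent) depend
-- only on relative order, hence are invariant under `punch a`; so the number of
-- permutations with a property P is a sum over the first value a of counts
-- of shorter permutations (`countPerm-suc`).  Iterating this gives transfer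
-- recursions for two refined counts:
--  * alternating permutations with prescribed first value obey the Entringer
--    (boustrophedon) recursion `ent`, whence E (n+1) = Σ_{k ≤ n} ent n k;
--  * a triple is even exactly when it is cyclically increasing, so the number
--    of permutations without 3-descents and with prescribed first two entries
--    depends only on the cyclic distance between them and obeys the same
--    recursion.
-- Summing over the second entry shows that every first value contributes
-- E (n+1) permutations without 3-descents; first value 1 gives (a) and all
-- n+2 first values give (b).

open import Defs
open import Data.Nat using (ℕ; zero; suc; _+_; _*_; _∸_; _<ᵇ_; _≡ᵇ_; _≤_; _<_; z≤n; s≤s; _<?_)
open import Data.Nat.Properties
open import Data.Product using (_×_; _,_; proj₁; proj₂)
open import Relation.Binary.PropositionalEquality
open import Data.Bool using (Bool; true; false; _∧_; not; _xor_; if_then_else_; T?)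
open import Data.Bool.Properties using (∧-assoc; ∧-zeroʳ; T-≡; ¬-not)
open import Data.Fin using (Fin; toℕ; punchIn) renaming (zero to fz; suc to fs)
open import Data.Fin.Properties using (punchInᵢ≢i; toℕ-injective)
open import Data.List using (List; []; _∷_; map; concat; length; filterᵇ; tabulate; _++_)
open import Data.List.Properties using (filter-++; length-++)
open import Data.Vec using (Vec; []; _∷_)
import Data.Vec as Vec
open import Function using (_∘_; id)
open import Function.Bundles using (Equivalence)
open import Relation.Nullary using (¬_; Dec; yes; no)

<ᵇ-true : ∀ {m n} → m < n → (m <ᵇ n) ≡ true
<ᵇ-true m<n = Equivalence.to T-≡ (<⇒<ᵇ m<n)

<ᵇ-false : ∀ {m n} → n ≤ m → (m <ᵇ n) ≡ false
<ᵇ-false {m} {n} n≤m = ¬-not (λ m<ᵇn → ≤⇒≯ n≤m (<ᵇ⇒< m n (Equivalence.from T-≡ m<ᵇn)))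

≡ᵇ-refl : ∀ n → (n ≡ᵇ n) ≡ true
≡ᵇ-refl n = Equivalence.to T-≡ (≡⇒≡ᵇ n n refl)

≡ᵇ-false : ∀ {m n} → ¬ m ≡ n → (m ≡ᵇ n) ≡ false
≡ᵇ-false {m} {n} m≢n = ¬-not (λ m≡ᵇn → m≢n (≡ᵇ⇒≡ m n (Equivalence.from T-≡ m≡ᵇn)))

count-cong : {A : Set} {p q : A → Bool} → (∀ x → p x ≡ q x) → (xs : List A) →
             count p xs ≡ count q xs
count-cong p≗q []       = refl
count-cong {p = p} {q} p≗q (x ∷ xs) with p x | q x | p≗q x
... | true  | .true  | refl = cong suc (count-cong p≗q xs)
... | false | .false | refl = count-cong p≗q xs

count-none : {A : Set} {p : A → Bool} → (∀ x → p x ≡ false) → (xs : List A) → count p xs ≡ 0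
count-none p≗false []       = refl
count-none {p = p} p≗false (x ∷ xs) with p x | p≗false x
... | .false | refl = count-none p≗false xs

count-++ : {A : Set} (p : A → Bool) (xs ys : List A) → count p (xs ++ ys) ≡ count p xs + count p ys
count-++ p xs ys = trans (cong length (filter-++ (T? ∘ p) xs ys)) (length-++ (filterᵇ p xs))

count-map : {A B : Set} (p : B → Bool) (f : A → B) (xs : List A) →
            count p (map f xs) ≡ count (p ∘ f) xs
count-map p f []       = refl
count-map p f (x ∷ xs) with p (f x)
... | true  = cong suc (count-map p f xs)
... | false = count-map p f xs

sumFin : (m : ℕ) → (Fin m → ℕ) → ℕ
sumFin zero    f = 0
sumFin (suc m) f = f fz + sumFin m (f ∘ fs)

sumFin-cong : ∀ m {f g : Fin m → ℕ} → (∀ i → f i ≡ g i) → sumFin m f ≡ sumFin m g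
sumFin-cong zero    f≗g = refl
sumFin-cong (suc m) f≗g = cong₂ _+_ (f≗g fz) (sumFin-cong m (f≗g ∘ fs))

sumFin-punchIn : ∀ m (a : Fin (suc m)) (f : Fin (suc m) → ℕ) →
                 sumFin (suc m) f ≡ f a + sumFin m (f ∘ punchIn a)
sumFin-punchIn m       fz     f = refl
sumFin-punchIn (suc m) (fs a) f = begin
  f fz + sumFin (suc m) (f ∘ fs)                    ≡⟨ cong (f fz +_) (sumFin-punchIn m a (f ∘ fs)) ⟩
  f fz + (f (fs a) + sumFin m (f ∘ fs ∘ punchIn a)) ≡⟨ sym (+-assoc (f fz) _ _) ⟩
  (f fz + f (fs a)) + sumFin m (f ∘ fs ∘ punchIn a) ≡⟨ cong (_+ sumFin m (f ∘ fs ∘ punchIn a)) (+-comm (f fz) (f (fs a))) ⟩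
  (f (fs a) + f fz) + sumFin m (f ∘ fs ∘ punchIn a) ≡⟨ +-assoc (f (fs a)) (f fz) _ ⟩
  f (fs a) + (f fz + sumFin m (f ∘ fs ∘ punchIn a)) ∎
  where open ≡-Reasoning

count-concat-tabulate : {A : Set} {m : ℕ} (p : A → Bool) (F : Fin m → List A) →
  ∀ k (f : Fin k → Fin m) → count p (concat (map F (tabulate f))) ≡ sumFin k (λ c → count p (F (f c)))
count-concat-tabulate p F zero    f = refl
count-concat-tabulate p F (suc k) f =
  trans (count-++ p (F (f fz)) _) (cong (count p (F (f fz)) +_) (count-concat-tabulate p F k (f ∘ fs)))

count-allWords-suc : ∀ k m (p : Vec (Fin m) (suc k) → Bool) →
  count p (allWords (suc k) m) ≡ sumFin m (λ c → count (λ w → p (c ∷ w)) (allWords k m))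
count-allWords-suc k m p =
  trans (count-concat-tabulate p (λ a → map (a ∷_) (allWords k m)) m id)
        (sumFin-cong m (λ c → count-map p (c ∷_) (allWords k m)))

-- Words over [m+1] avoiding the letter a correspond to words over [m] via
-- punchIn a; this is the bijection behind "delete the first value".
count-avoiding : ∀ k m (a : Fin (suc m)) (q : Vec (Fin (suc m)) k → Bool) →
  count (λ w → notIn (toℕ a) (vals w) ∧ q w) (allWords k (suc m))
  ≡ count (λ w → q (Vec.map (punchIn a) w)) (allWords k m)
count-avoiding zero m a q with q []
... | true  = refl
... | false = refl
count-avoiding (suc k) m a q = begin
  count P (allWords (suc k) (suc m))
    ≡⟨ count-allWords-suc k (suc m) P ⟩
  sumFin (suc m) (λ c → count (λ w → P (c ∷ w)) (allWords k (suc m)))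
    ≡⟨ sumFin-punchIn m a (λ c → count (λ w → P (c ∷ w)) (allWords k (suc m))) ⟩
  count (λ w → P (a ∷ w)) (allWords k (suc m)) + sumFin m (λ c → count (λ w → P (punchIn a c ∷ w)) (allWords k (suc m)))
    ≡⟨ cong₂ _+_ first-letter-a (sumFin-cong m first-letter-other) ⟩
  sumFin m (λ c → count (λ w → Q (c ∷ w)) (allWords k m))
    ≡⟨ count-allWords-suc k m Q ⟨
  count Q (allWords (suc k) m) ∎
  where
  open ≡-Reasoning
  P : Vec (Fin (suc m)) (suc k) → Bool
  P w = notIn (toℕ a) (vals w) ∧ q w
  Q : Vec (Fin m) (suc k) → Bool
  Q w = q (Vec.map (punchIn a) w)
  first-letter-a : count (λ w → P (a ∷ w)) (allWords k (suc m)) ≡ 0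
  first-letter-a = count-none
    (λ w → cong (λ t → (not t ∧ notIn (toℕ a) (vals w)) ∧ q (a ∷ w)) (≡ᵇ-refl (toℕ a)))
    (allWords k (suc m))
  first-letter-other : ∀ c → count (λ w → P (punchIn a c ∷ w)) (allWords k (suc m))
                           ≡ count (λ w → Q (c ∷ w)) (allWords k m)
  first-letter-other c = trans
    (count-cong (λ w → cong (λ t → (not t ∧ notIn (toℕ a) (vals w)) ∧ q (punchIn a c ∷ w))
                            (≡ᵇ-false (λ eq → punchInᵢ≢i a c (sym (toℕ-injective eq)))))
                (allWords k (suc m)))
    (count-avoiding k m a (λ w → q (punchIn a c ∷ w)))

punch : ℕ → ℕ → ℕ
punch a v = if v <ᵇ a then v else suc v

punch-suc : ∀ a v → punch (suc a) (suc v) ≡ suc (punch a v)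
punch-suc a v with v <ᵇ a
... | true  = refl
... | false = refl

toℕ-punchIn : ∀ {m} (a : Fin (suc m)) (j : Fin m) → toℕ (punchIn a j) ≡ punch (toℕ a) (toℕ j)
toℕ-punchIn         fz     j      = refl
toℕ-punchIn {suc m} (fs a) fz     = refl
toℕ-punchIn {suc m} (fs a) (fs j) = trans (cong suc (toℕ-punchIn a j)) (sym (punch-suc (toℕ a) (toℕ j)))

vals-map-punchIn : ∀ {k m} (a : Fin (suc m)) (w : Vec (Fin m) k) →
                   vals (Vec.map (punchIn a) w) ≡ map (punch (toℕ a)) (vals w)
vals-map-punchIn a []      = refl
vals-map-punchIn a (x ∷ w) = cong₂ _∷_ (toℕ-punchIn a x) (vals-map-punchIn a w)

punch-≡ᵇ : ∀ a x y → (punch a x ≡ᵇ punch a y) ≡ (x ≡ᵇ y)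
punch-≡ᵇ zero    x       y       = refl
punch-≡ᵇ (suc a) zero    zero    = refl
punch-≡ᵇ (suc a) zero    (suc y) rewrite punch-suc a y = refl
punch-≡ᵇ (suc a) (suc x) zero    rewrite punch-suc a x = refl
punch-≡ᵇ (suc a) (suc x) (suc y) rewrite punch-suc a x | punch-suc a y = punch-≡ᵇ a x y

punch-<ᵇ : ∀ a x y → (punch a x <ᵇ punch a y) ≡ (x <ᵇ y)
punch-<ᵇ zero    x       y       = refl
punch-<ᵇ (suc a) zero    zero    = refl
punch-<ᵇ (suc a) zero    (suc y) rewrite punch-suc a y = refl
punch-<ᵇ (suc a) (suc x) zero    = refl
punch-<ᵇ (suc a) (suc x) (suc y) rewrite punch-suc a x | punch-suc a y = punch-<ᵇ a x y

punch-<ᵇ-skipped : ∀ a x → (punch a x <ᵇ a) ≡ (x <ᵇ a)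
punch-<ᵇ-skipped zero    x       = refl
punch-<ᵇ-skipped (suc a) zero    = refl
punch-<ᵇ-skipped (suc a) (suc x) rewrite punch-suc a x = punch-<ᵇ-skipped a x

skipped-<ᵇ-punch : ∀ a x → (a <ᵇ punch a x) ≡ not (x <ᵇ a)
skipped-<ᵇ-punch zero    x       = refl
skipped-<ᵇ-punch (suc a) zero    = refl
skipped-<ᵇ-punch (suc a) (suc x) rewrite punch-suc a x = skipped-<ᵇ-punch a x

notIn-punch : ∀ a x l → notIn (punch a x) (map (punch a) l) ≡ notIn x l
notIn-punch a x []      = refl
notIn-punch a x (y ∷ l) = cong₂ (λ u v → not u ∧ v) (punch-≡ᵇ a x y) (notIn-punch a x l)

distinct-punch : ∀ a l → distinct (map (punch a) l) ≡ distinct l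
distinct-punch a []      = refl
distinct-punch a (x ∷ l) = cong₂ _∧_ (notIn-punch a x l) (distinct-punch a l)

oddPattern-punch : ∀ a x y z → oddPattern (punch a x) (punch a y) (punch a z) ≡ oddPattern x y z
oddPattern-punch a x y z rewrite punch-<ᵇ a y x | punch-<ᵇ a z x | punch-<ᵇ a z y = refl

noThreeDescent-punch : ∀ a l → noThreeDescent (map (punch a) l) ≡ noThreeDescent l
noThreeDescent-punch a []              = refl
noThreeDescent-punch a (x ∷ [])        = refl
noThreeDescent-punch a (x ∷ y ∷ [])    = refl
noThreeDescent-punch a (x ∷ y ∷ z ∷ l) =
  cong₂ (λ u v → not u ∧ v) (oddPattern-punch a x y z) (noThreeDescent-punch a (y ∷ z ∷ l))

alt-punch : ∀ a u l → alt u (map (punch a) l) ≡ alt u l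
alt-punch a u     []          = refl
alt-punch a u     (x ∷ [])    = refl
alt-punch a true  (x ∷ y ∷ l) = cong₂ _∧_ (punch-<ᵇ a x y) (alt-punch a false (y ∷ l))
alt-punch a false (x ∷ y ∷ l) = cong₂ _∧_ (punch-<ᵇ a y x) (alt-punch a true (y ∷ l))

countPerm : ℕ → (List ℕ → Bool) → ℕ
countPerm n P = count (λ v → isPerm v ∧ P (vals v)) (allWords n n)

countPerm-cong : ∀ n {P Q : List ℕ → Bool} → (∀ l → P l ≡ Q l) → countPerm n P ≡ countPerm n Q
countPerm-cong n P≗Q = count-cong (λ v → cong (isPerm v ∧_) (P≗Q (vals v))) (allWords n n)

countPerm-guard : ∀ n b P → countPerm n (λ l → b ∧ P l) ≡ (if b then countPerm n P else 0)
countPerm-guard n true  P = refl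
countPerm-guard n false P = count-none (λ v → ∧-zeroʳ (isPerm v)) (allWords n n)

sumTo : ℕ → (ℕ → ℕ) → ℕ
sumTo zero    f = 0
sumTo (suc m) f = f 0 + sumTo m (f ∘ suc)

sumFin-toℕ : ∀ m (h : ℕ → ℕ) → sumFin m (λ a → h (toℕ a)) ≡ sumTo m h
sumFin-toℕ zero    h = refl
sumFin-toℕ (suc m) h = cong (h 0 +_) (sumFin-toℕ m (h ∘ suc))

sumTo-cong : ∀ m {f g : ℕ → ℕ} → (∀ i → i < m → f i ≡ g i) → sumTo m f ≡ sumTo m g
sumTo-cong zero    f≗g = refl
sumTo-cong (suc m) f≗g = cong₂ _+_ (f≗g 0 (s≤s z≤n)) (sumTo-cong m (λ i i<m → f≗g (suc i) (s≤s i<m)))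

sumTo-const : ∀ m s → sumTo m (λ _ → s) ≡ m * s
sumTo-const zero    s = refl
sumTo-const (suc m) s = cong (s +_) (sumTo-const m s)

sumTo-+ : ∀ p q f → sumTo (p + q) f ≡ sumTo p f + sumTo q (λ i → f (p + i))
sumTo-+ zero    q f = refl
sumTo-+ (suc p) q f = trans (cong (f 0 +_) (sumTo-+ p q (f ∘ suc))) (sym (+-assoc (f 0) _ _))

sumTo-truncate : ∀ K m f → K ≤ m → sumTo m (λ i → if i <ᵇ K then f i else 0) ≡ sumTo K f
sumTo-truncate zero    m       f _         = trans (sumTo-const m 0) (*-zeroʳ m)
sumTo-truncate (suc K) (suc m) f (s≤s K≤m) = cong (f 0 +_) (sumTo-truncate K m (f ∘ suc) K≤m)

sumTo-snoc : ∀ m h → sumTo (suc m) h ≡ sumTo m h + h m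
sumTo-snoc zero    h = +-comm (h 0) 0
sumTo-snoc (suc m) h = trans (cong (h 0 +_) (sumTo-snoc m (h ∘ suc))) (sym (+-assoc (h 0) _ _))

sumTo-reverse : ∀ m h → sumTo m h ≡ sumTo m (λ i → h (m ∸ suc i))
sumTo-reverse zero    h = refl
sumTo-reverse (suc m) h =
  trans (sumTo-snoc m h) (trans (+-comm (sumTo m h) (h m)) (cong (h m +_) (sumTo-reverse m h)))

shift : ℕ → ℕ → ℕ → ℕ
shift m a c = if c <ᵇ a then m + c ∸ a else c ∸ a

sumTo-shift : ∀ a m g → a ≤ m → sumTo m (λ c → g (shift m a c)) ≡ sumTo m g
sumTo-shift a m g a≤m =
  subst (λ z → sumTo z (λ c → g (shift z a c)) ≡ sumTo z g) (m+[n∸m]≡n a≤m) (rotate a (m ∸ a))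
  where
  rotate : ∀ a r → sumTo (a + r) (λ c → g (shift (a + r) a c)) ≡ sumTo (a + r) g
  rotate a r = begin
    sumTo (a + r) (λ c → g (shift (a + r) a c))
      ≡⟨ sumTo-+ a r _ ⟩
    sumTo a (λ c → g (shift (a + r) a c)) + sumTo r (λ i → g (shift (a + r) a (a + i)))
      ≡⟨ cong₂ _+_ (sumTo-cong a wrapped) (sumTo-cong r unwrapped) ⟩
    sumTo a (λ c → g (r + c)) + sumTo r g
      ≡⟨ +-comm (sumTo a (λ c → g (r + c))) (sumTo r g) ⟩
    sumTo r g + sumTo a (λ c → g (r + c))
      ≡⟨ sumTo-+ r a g ⟨
    sumTo (r + a) g
      ≡⟨ cong (λ z → sumTo z g) (+-comm r a) ⟩
    sumTo (a + r) g ∎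
    where
    open ≡-Reasoning
    wrapped : ∀ c → c < a → g (shift (a + r) a c) ≡ g (r + c)
    wrapped c c<a rewrite <ᵇ-true c<a = cong g (trans (cong (_∸ a) (+-assoc a r c)) (m+n∸m≡n a (r + c)))
    unwrapped : ∀ i → i < r → g (shift (a + r) a (a + i)) ≡ g i
    unwrapped i _ rewrite <ᵇ-false {a + i} {a} (m≤m+n a i) = cong g (m+n∸m≡n a i)

-- Entringer numbers, given by the boustrophedon recursion
-- ent (n+1) k = Σ_{i<k} ent n (n-i); ent n k will count the alternating
-- permutations of [n+1] with first value k whose first step goes down.

ent : ℕ → ℕ → ℕ
ent zero    k = 1
ent (suc n) k = sumTo k (λ i → ent n (n ∸ i))

-- The row sum of ent n; it will be identified with E (n+1).
entRow : ℕ → ℕ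
entRow n = sumTo (suc n) (λ i → ent n (n ∸ i))

countPerm-suc : ∀ n P → countPerm (suc n) P ≡ sumTo (suc n) (λ a → countPerm n (λ l → P (a ∷ map (punch a) l)))
countPerm-suc n P =
  trans (count-allWords-suc n (suc n) (λ v → isPerm v ∧ P (vals v)))
  (trans (sumFin-cong (suc n) by-first-value)
         (sumFin-toℕ (suc n) (λ a → countPerm n (λ l → P (a ∷ map (punch a) l)))))
  where
  by-first-value : ∀ a → count (λ w → isPerm (a ∷ w) ∧ P (vals (a ∷ w))) (allWords n (suc n))
                       ≡ countPerm n (λ l → P (toℕ a ∷ map (punch (toℕ a)) l))
  by-first-value a = begin
    count (λ w → isPerm (a ∷ w) ∧ P (vals (a ∷ w))) (allWords n (suc n))
      ≡⟨ count-cong (λ w → ∧-assoc (notIn (toℕ a) (vals w)) (distinct (vals w)) (P (toℕ a ∷ vals w)))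
                    (allWords n (suc n)) ⟩
    count (λ w → notIn (toℕ a) (vals w) ∧ (distinct (vals w) ∧ P (toℕ a ∷ vals w))) (allWords n (suc n))
      ≡⟨ count-avoiding n n a (λ w → distinct (vals w) ∧ P (toℕ a ∷ vals w)) ⟩
    count (λ w → distinct (vals (Vec.map (punchIn a) w)) ∧ P (toℕ a ∷ vals (Vec.map (punchIn a) w))) (allWords n n)
      ≡⟨ count-cong relabel (allWords n n) ⟩
    countPerm n (λ l → P (toℕ a ∷ map (punch (toℕ a)) l)) ∎
    where
    open ≡-Reasoning
    relabel : ∀ w → (distinct (vals (Vec.map (punchIn a) w)) ∧ P (toℕ a ∷ vals (Vec.map (punchIn a) w)))
                  ≡ (isPerm w ∧ P (toℕ a ∷ map (punch (toℕ a)) (vals w)))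
    relabel w rewrite vals-map-punchIn a w = cong (_∧ P (toℕ a ∷ map (punch (toℕ a)) (vals w)))
                                                  (distinct-punch (toℕ a) (vals w))

-- Alternating permutations of [n+1] with first value a; u says whether the
-- first step goes up.

altFrom : ℕ → ℕ → Bool → ℕ
altFrom n a u = countPerm n (λ l → alt u (a ∷ map (punch a) l))

stepAllowed : Bool → ℕ → ℕ → Bool
stepAllowed u a b = if u then not (b <ᵇ a) else b <ᵇ a

altFrom-suc : ∀ n a u → altFrom (suc n) a u ≡ sumTo (suc n) (λ b → if stepAllowed u a b then altFrom n b (not u) else 0)
altFrom-suc n a u = trans (countPerm-suc n (λ l → alt u (a ∷ map (punch a) l)))
  (sumTo-cong (suc n) (λ b _ → trans
    (countPerm-cong n (first-step u b))
    (countPerm-guard n (stepAllowed u a b) (λ l → alt (not u) (b ∷ map (punch b) l)))))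
  where
  first-step : ∀ u b l → alt u (a ∷ map (punch a) (b ∷ map (punch b) l))
                       ≡ (stepAllowed u a b ∧ alt (not u) (b ∷ map (punch b) l))
  first-step true  b l = cong₂ _∧_ (skipped-<ᵇ-punch a b) (alt-punch a false (b ∷ map (punch b) l))
  first-step false b l = cong₂ _∧_ (punch-<ᵇ-skipped a b) (alt-punch a true (b ∷ map (punch b) l))

not-<ᵇ : ∀ m n → not (m <ᵇ n) ≡ (n <ᵇ suc m)
not-<ᵇ m       zero    = refl
not-<ᵇ zero    (suc n) = refl
not-<ᵇ (suc m) (suc n) = not-<ᵇ m n

<ᵇ-∸ʳ : ∀ a i M → (a <ᵇ M ∸ i) ≡ (a + i <ᵇ M)
<ᵇ-∸ʳ a zero    M       = cong (_<ᵇ M) (sym (+-identityʳ a))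
<ᵇ-∸ʳ a (suc i) zero    = sym (<ᵇ-false {a + suc i} {0} z≤n)
<ᵇ-∸ʳ a (suc i) (suc M) = trans (<ᵇ-∸ʳ a i M) (cong (_<ᵇ suc M) (sym (+-suc a i)))

-- Reversing the order of the remaining values turns "b ≥ a" into "i < n+1-a".
reflect-threshold : ∀ n i a → i ≤ n → not ((n ∸ i) <ᵇ a) ≡ (i <ᵇ suc n ∸ a)
reflect-threshold n i a i≤n = begin
  not ((n ∸ i) <ᵇ a)    ≡⟨ not-<ᵇ (n ∸ i) a ⟩
  (a <ᵇ suc (n ∸ i))    ≡⟨ cong (a <ᵇ_) (+-∸-assoc 1 i≤n) ⟨
  (a <ᵇ suc n ∸ i)      ≡⟨ <ᵇ-∸ʳ a i (suc n) ⟩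
  (a + i <ᵇ suc n)      ≡⟨ cong (_<ᵇ suc n) (+-comm a i) ⟩
  (i + a <ᵇ suc n)      ≡⟨ <ᵇ-∸ʳ i a (suc n) ⟨
  (i <ᵇ suc n ∸ a)      ∎
  where open ≡-Reasoning

altFrom-ent : ∀ n a → a ≤ n → (altFrom n a true ≡ ent n (n ∸ a)) × (altFrom n a false ≡ ent n a)
altFrom-ent zero    a _   = refl , refl
altFrom-ent (suc n) a a≤ = up , down
  where
  IH : ∀ b → b < suc n → (altFrom n b true ≡ ent n (n ∸ b)) × (altFrom n b false ≡ ent n b)
  IH b (s≤s b≤n) = altFrom-ent n b b≤n
  open ≡-Reasoning
  down : altFrom (suc n) a false ≡ ent (suc n) a
  down = begin
    altFrom (suc n) a false
      ≡⟨ altFrom-suc n a false ⟩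
    sumTo (suc n) (λ b → if b <ᵇ a then altFrom n b true else 0)
      ≡⟨ sumTo-cong (suc n) (λ b b< → cong (if b <ᵇ a then_else 0) (proj₁ (IH b b<))) ⟩
    sumTo (suc n) (λ b → if b <ᵇ a then ent n (n ∸ b) else 0)
      ≡⟨ sumTo-truncate a (suc n) (λ b → ent n (n ∸ b)) a≤ ⟩
    ent (suc n) a ∎
  up : altFrom (suc n) a true ≡ ent (suc n) (suc n ∸ a)
  up = begin
    altFrom (suc n) a true
      ≡⟨ altFrom-suc n a true ⟩
    sumTo (suc n) (λ b → if not (b <ᵇ a) then altFrom n b false else 0)
      ≡⟨ sumTo-cong (suc n) (λ b b< → cong (if not (b <ᵇ a) then_else 0) (proj₂ (IH b b<))) ⟩
    sumTo (suc n) (λ b → if not (b <ᵇ a) then ent n b else 0)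
      ≡⟨ sumTo-reverse (suc n) (λ b → if not (b <ᵇ a) then ent n b else 0) ⟩
    sumTo (suc n) (λ i → if not ((n ∸ i) <ᵇ a) then ent n (n ∸ i) else 0)
      ≡⟨ sumTo-cong (suc n) (λ i i< → cong (if_then ent n (n ∸ i) else 0) (reflect-threshold n i a (≤-pred i<))) ⟩
    sumTo (suc n) (λ i → if i <ᵇ suc n ∸ a then ent n (n ∸ i) else 0)
      ≡⟨ sumTo-truncate (suc n ∸ a) (suc n) (λ i → ent n (n ∸ i)) (m∸n≤m (suc n) a) ⟩
    ent (suc n) (suc n ∸ a) ∎

E-suc : ∀ n → E (suc n) ≡ entRow n
E-suc n = trans (countPerm-suc n upDown)
  (sumTo-cong (suc n) (λ a a< → proj₁ (altFrom-ent n a (≤-pred a<))))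

-- Permutations of [n+2] without 3-descents whose first two values are x and
-- (relative to the remaining ones) b.

no3From : ℕ → ℕ → ℕ → ℕ
no3From n x b = countPerm n (λ l → noThreeDescent (x ∷ punch x b ∷ map (punch x) (map (punch b) l)))

-- The triple (x, punch x b, punch x (punch b c)) is even.
evenTriple : ℕ → ℕ → ℕ → Bool
evenTriple x b c = not ((b <ᵇ x) xor ((punch b c <ᵇ x) xor (c <ᵇ b)))

no3From-suc : ∀ n x b → no3From (suc n) x b ≡ sumTo (suc n) (λ c → if evenTriple x b c then no3From n b c else 0)
no3From-suc n x b = trans (countPerm-suc n (λ l → noThreeDescent (x ∷ punch x b ∷ map (punch x) (map (punch b) l))))
  (sumTo-cong (suc n) (λ c _ → trans
    (countPerm-cong n (first-triple c))
    (countPerm-guard n (evenTriple x b c) (λ l → noThreeDescent (b ∷ punch b c ∷ map (punch b) (map (punch c) l))))))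
  where
  first-triple : ∀ c l → noThreeDescent (x ∷ punch x b ∷ map (punch x) (map (punch b) (c ∷ map (punch c) l)))
                       ≡ (evenTriple x b c ∧ noThreeDescent (b ∷ punch b c ∷ map (punch b) (map (punch c) l)))
  first-triple c l rewrite punch-<ᵇ-skipped x b | punch-<ᵇ-skipped x (punch b c)
                         | punch-<ᵇ x (punch b c) b | punch-<ᵇ-skipped b c =
    cong (evenTriple x b c ∧_) (noThreeDescent-punch x (b ∷ punch b c ∷ map (punch b) (map (punch c) l)))

+-<ᵇ-cancelʳ : ∀ a b k → (a + k <ᵇ b + k) ≡ (a <ᵇ b)
+-<ᵇ-cancelʳ a b zero    rewrite +-identityʳ a | +-identityʳ b = refl
+-<ᵇ-cancelʳ a b (suc k) rewrite +-suc a k | +-suc b k = +-<ᵇ-cancelʳ a b k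

∸-<ᵇ : ∀ {x P} M → x ≤ P → (P ∸ x <ᵇ M) ≡ (P <ᵇ M + x)
∸-<ᵇ {x} {P} M x≤P = trans (sym (+-<ᵇ-cancelʳ (P ∸ x) M x)) (cong (_<ᵇ M + x) (m∸n+n≡m x≤P))

∸-chain : ∀ {y z w} → y ≤ z → z ≤ w → (w ∸ z) + (z ∸ y) ≡ w ∸ y
∸-chain {y} {z} {w} y≤z z≤w = sym (trans (cong (_∸ y) (sym (m∸n+n≡m z≤w))) (+-∸-assoc (w ∸ z) y≤z))

-- Evenness means cyclic increase: in the cyclic order of the remaining m = n+1
-- values starting after the second entry, the third entry comes before x.
-- Both sides are compared through shift m b c + shift (m+1) x b < m.
evenTriple-shift : ∀ n x b c → x ≤ suc (suc n) → b ≤ suc n → c ≤ n →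
  evenTriple x b c ≡ (shift (suc n) b c <ᵇ suc n ∸ shift (suc (suc n)) x b)
evenTriple-shift n x b c x≤ b≤ c≤ =
  trans (by-cases (b <? x) (c <? b)) (sym (<ᵇ-∸ʳ (shift m b c) (shift (suc m) x b) m))
  where
  m = suc n
  xor-lemma₁ : ∀ p → not (true xor (p xor false)) ≡ p
  xor-lemma₁ true  = refl
  xor-lemma₁ false = refl
  xor-lemma₂ : ∀ p → not (false xor (p xor true)) ≡ p
  xor-lemma₂ true  = refl
  xor-lemma₂ false = refl
  by-cases : Dec (b < x) → Dec (c < b) → evenTriple x b c ≡ (shift m b c + shift (suc m) x b <ᵇ m)
  -- Both shifts wrap around, so the distances already exceed m: odd triple.
  by-cases (yes b<x) (yes c<b) rewrite <ᵇ-true b<x | <ᵇ-true c<b | <ᵇ-true (<-trans c<b b<x) =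
    sym (<ᵇ-false {(m + c ∸ b) + (suc m + b ∸ x)} {m} (begin
      m                                   ≡⟨ m∸n+n≡m b≤ ⟨
      (m ∸ b) + b                         ≤⟨ +-mono-≤ (∸-monoˡ-≤ b (m≤m+n m c)) (m≤n+m b (suc m ∸ x)) ⟩
      (m + c ∸ b) + ((suc m ∸ x) + b)     ≡⟨ cong ((m + c ∸ b) +_) (+-∸-comm b x≤) ⟨
      (m + c ∸ b) + (suc m + b ∸ x)       ∎))
    where open ≤-Reasoning
  -- Only the shift of b wraps: the triple is even iff c+1 < x.
  by-cases (yes b<x) (no c≮b) rewrite <ᵇ-true b<x | <ᵇ-false (≮⇒≥ c≮b) = begin
    not (true xor ((suc c <ᵇ x) xor false))  ≡⟨ xor-lemma₁ (suc c <ᵇ x) ⟩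
    (suc c <ᵇ x)                             ≡⟨ +-<ᵇ-cancelʳ (suc c) x m ⟨
    (suc c + m <ᵇ x + m)                     ≡⟨ cong₂ _<ᵇ_ (sym (+-suc c m)) (+-comm x m) ⟩
    (c + suc m <ᵇ m + x)                     ≡⟨ ∸-<ᵇ m (≤-trans x≤ (m≤n+m (suc m) c)) ⟨
    (c + suc m ∸ x <ᵇ m)                     ≡⟨ cong (_<ᵇ m) distance ⟨
    ((c ∸ b) + (suc m + b ∸ x) <ᵇ m)         ∎
    where
    open ≡-Reasoning
    distance : (c ∸ b) + (suc m + b ∸ x) ≡ c + suc m ∸ x
    distance = begin
      (c ∸ b) + (suc m + b ∸ x)    ≡⟨ cong ((c ∸ b) +_) (trans (+-∸-comm b x≤) (+-comm (suc m ∸ x) b)) ⟩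
      (c ∸ b) + (b + (suc m ∸ x))  ≡⟨ +-assoc (c ∸ b) b _ ⟨
      (c ∸ b + b) + (suc m ∸ x)    ≡⟨ cong (_+ (suc m ∸ x)) (m∸n+n≡m (≮⇒≥ c≮b)) ⟩
      c + (suc m ∸ x)              ≡⟨ +-∸-assoc c x≤ ⟨
      c + suc m ∸ x                ∎
  -- Only the shift of c wraps: the triple is even iff c < x.
  by-cases (no b≮x) (yes c<b) rewrite <ᵇ-false (≮⇒≥ b≮x) | <ᵇ-true c<b = begin
    not (false xor ((c <ᵇ x) xor true))      ≡⟨ xor-lemma₂ (c <ᵇ x) ⟩
    (c <ᵇ x)                                 ≡⟨ +-<ᵇ-cancelʳ c x m ⟨
    (c + m <ᵇ x + m)                         ≡⟨ cong₂ _<ᵇ_ (+-comm c m) (+-comm x m) ⟩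
    (m + c <ᵇ m + x)                         ≡⟨ ∸-<ᵇ m x≤m+c ⟨
    (m + c ∸ x <ᵇ m)                         ≡⟨ cong (_<ᵇ m) (∸-chain (≮⇒≥ b≮x) (≤-trans b≤ (m≤m+n m c))) ⟨
    ((m + c ∸ b) + (b ∸ x) <ᵇ m)             ∎
    where
    open ≡-Reasoning
    x≤m+c : x ≤ m + c
    x≤m+c = ≤-trans (≮⇒≥ b≮x) (≤-trans b≤ (m≤m+n m c))
  -- No shift wraps: x ≤ b ≤ c, the triple is increasing and c - x < m.
  by-cases (no b≮x) (no c≮b) rewrite <ᵇ-false (≮⇒≥ b≮x) | <ᵇ-false (≮⇒≥ c≮b)
                                   | <ᵇ-false {suc c} {x} (≤-trans (≮⇒≥ b≮x) (≤-trans (≮⇒≥ c≮b) (n≤1+n c))) =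
    sym (trans (cong (_<ᵇ m) (∸-chain (≮⇒≥ b≮x) (≮⇒≥ c≮b)))
               (<ᵇ-true (≤-trans (s≤s (m∸n≤m c x)) (s≤s c≤))))

no3From-ent : ∀ n x b → x ≤ suc n → b ≤ n → no3From n x b ≡ ent n (n ∸ shift (suc n) x b)
no3From-ent zero    x b _  _  = refl
no3From-ent (suc n) x b x≤ b≤ = begin
  no3From (suc n) x b
    ≡⟨ no3From-suc n x b ⟩
  sumTo (suc n) (λ c → if evenTriple x b c then no3From n b c else 0)
    ≡⟨ sumTo-cong (suc n) by-third-value ⟩
  sumTo (suc n) (λ c → g (shift (suc n) b c))
    ≡⟨ sumTo-shift b (suc n) g b≤ ⟩
  sumTo (suc n) g
    ≡⟨ sumTo-truncate K (suc n) (λ i → ent n (n ∸ i)) (m∸n≤m (suc n) (shift (suc (suc n)) x b)) ⟩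
  ent (suc n) K ∎
  where
  open ≡-Reasoning
  K = suc n ∸ shift (suc (suc n)) x b
  g : ℕ → ℕ
  g i = if i <ᵇ K then ent n (n ∸ i) else 0
  by-third-value : ∀ c → c < suc n → (if evenTriple x b c then no3From n b c else 0) ≡ g (shift (suc n) b c)
  by-third-value c (s≤s c≤n) rewrite no3From-ent n b c b≤ c≤n | evenTriple-shift n x b c x≤ b≤ c≤n = refl

no3-first-value : ∀ n a → a ≤ suc n → countPerm (suc n) (λ l → noThreeDescent (a ∷ map (punch a) l)) ≡ entRow n
no3-first-value n a a≤ = begin
  countPerm (suc n) (λ l → noThreeDescent (a ∷ map (punch a) l))
    ≡⟨ countPerm-suc n (λ l → noThreeDescent (a ∷ map (punch a) l)) ⟩
  sumTo (suc n) (no3From n a)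
    ≡⟨ sumTo-cong (suc n) (λ b b< → no3From-ent n a b a≤ (≤-pred b<)) ⟩
  sumTo (suc n) (λ b → ent n (n ∸ shift (suc n) a b))
    ≡⟨ sumTo-shift a (suc n) (λ i → ent n (n ∸ i)) a≤ ⟩
  entRow n ∎
  where open ≡-Reasoning

countTildeNo3-suc : ∀ n → countTildeNo3 (suc n) ≡ entRow n
countTildeNo3-suc n = begin
  countTildeNo3 (suc n)
    ≡⟨ countPerm-suc (suc n) (λ l → firstIsOne l ∧ noThreeDescent l) ⟩
  countPerm (suc n) (λ l → noThreeDescent (0 ∷ map (punch 0) l)) + sumTo (suc n) (λ a → countPerm (suc n) (λ l → false ∧ noThreeDescent (suc a ∷ map (punch (suc a)) l)))
    ≡⟨ cong₂ _+_ (no3-first-value n 0 z≤n) other-first-values ⟩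
  entRow n + 0
    ≡⟨ +-identityʳ (entRow n) ⟩
  entRow n ∎
  where
  open ≡-Reasoning
  other-first-values : sumTo (suc n) (λ a → countPerm (suc n) (λ l → false ∧ noThreeDescent (suc a ∷ map (punch (suc a)) l))) ≡ 0
  other-first-values = trans
    (sumTo-cong (suc n) (λ a _ → countPerm-guard (suc n) false (λ l → noThreeDescent (suc a ∷ map (punch (suc a)) l))))
    (trans (sumTo-const (suc n) 0) (*-zeroʳ n))

countNo3-suc : ∀ n → countNo3 (suc n) ≡ suc (suc n) * entRow n
countNo3-suc n = trans (countPerm-suc (suc n) noThreeDescent)
  (trans (sumTo-cong (suc (suc n)) (λ a a< → no3-first-value n a (≤-pred a<)))
         (sumTo-const (suc (suc n)) (entRow n)))

corollary2p4 : (n : ℕ) →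
    (countTildeNo3 n ≡ E n) × (countNo3 n ≡ suc n * E n)
corollary2p4 zero    = refl , refl
corollary2p4 (suc n) =
  trans (countTildeNo3-suc n) (sym (E-suc n)) ,
  trans (countNo3-suc n) (cong (suc (suc n) *_) (sym (E-suc n)))
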